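{- Let $n>2$ be even and let $T$ be a perfect $n$-ary tree in which every leaf vertex is at depth $2$. Then $\sigma^{ - }(T)=n/2$.
   Context: For a connected simple graph $G$ of order $p$, a parity labelling is a bijection $f:V(G)\to\{1,\ldots,p\}$; an edge $uv$ is negative if $f(u),f(v)$ have opposite parity. The rna number $\sigma^{ - }(G)$ is the minimum over all such $f$ of the number of negative edges. For a rooted tree with root $u_0$, the depth of a vertex $u$ is $d(u,u_0)$. A perfect $k$-ary tree is a rooted tree in which all leaf vertices are at the same depth and all internal (non-leaf) vertices, including the root, have degree $k$. -}

module Defs where

open import Data.Nat using (ℕ; suc; _+_; _*_; _∸_; _%_; _≡ᵇ_)
open import Data.Bool using (Bool; not)
open import Data.Fin using (Fin; toℕ)
open import Data.Unit using (⊤; tt)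
open import Data.Sum using (_⊎_; inj₁; inj₂)
open import Data.Product using (_×_; _,_)
open import Data.List using (List; map; concatMap; length; filterᵇ; _++_)
open import Data.List using (allFin) public
open import Function.Bundles using (_⤖_; Bijection)

-- A finite simple graph given by a vertex type, its order p and its
-- edge list (each edge listed once).

record Graph : Set₁ where
  field
    V     : Set
    order : ℕ
    edges : List (V × V)

open Graph public

-- A parity labelling: a bijection V(G) → {1,…,p}; we represent
-- {1,…,p} by Fin p, the label of v being 1 + toℕ (f v).
Labelling : Graph → Set
Labelling G = V G ⤖ Fin (order G)

label : (G : Graph) → Labelling G → V G → ℕ
label G f v = suc (toℕ (Bijection.to f v))

isNegative : ℕ → ℕ → Bool
isNegative a b = not ((a % 2) ≡ᵇ (b % 2))

negEdges : (G : Graph) → Labelling G → ℕ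
negEdges G f =
  length (filterᵇ (λ e → isNegative (label G f (Data.Product.proj₁ e))
                                     (label G f (Data.Product.proj₂ e)))
                  (edges G))

-- The perfect n-ary tree with all leaves at depth 2.
-- Root (degree n) has n children; each child (degree n) has n-1 leaf
-- children.  Vertices: root ⊎ depth-1 vertex i ⊎ leaf (i , j).

PVertex : ℕ → Set
PVertex n = ⊤ ⊎ (Fin n ⊎ (Fin n × Fin (n ∸ 1)))

root : ∀ {n} → PVertex n
root = inj₁ tt

mid : ∀ {n} → Fin n → PVertex n
mid i = inj₂ (inj₁ i)

leaf : ∀ {n} → Fin n → Fin (n ∸ 1) → PVertex n
leaf i j = inj₂ (inj₂ (i , j))

perfectTreeDepth2 : ℕ → Graph
perfectTreeDepth2 n = record
  { V     = PVertex n
  ; order = 1 + n + n * (n ∸ 1)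
  ; edges = map (λ i → (root , mid i)) (allFin n)
            ++ concatMap (λ i → map (λ j → (mid i , leaf i j)) (allFin (n ∸ 1)))
                         (allFin n)
  }

-- Write n = 2m and call a branch a depth-1 vertex together with its n − 1
-- leaves. Colouring vertices by the parity of their labels, a branch
-- carries no negative edge (counting the edge from the root) only if all of
-- its n vertices have the parity of the root; otherwise it carries at least
-- one. Hence, per branch, (vertices of the other parity) ≤ n · (negative
-- edges). The labels 1, …, n² + 1 contain at least n²/2 = n m labels of the
-- parity opposite to any given one, so summing over branches gives
-- n m ≤ n · σ⁻, i.e. m ≤ σ⁻. Conversely, labelling the root 1 and the j-th
-- vertex of branch i (the 0-th being its depth-1 vertex) by 2 + n j + i makes
-- every branch monochromatic of the parity of i, so exactly the m branches
-- with i even cost one edge each.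
module Submission where

open import Defs
open import Data.Nat using (ℕ; _<_; _≤_; _/_)
open import Data.Nat.Divisibility using (_∣_)
open import Data.Product using (_×_; Σ)
open import Relation.Binary.PropositionalEquality using (_≡_)

open import Data.Bool using (Bool; true; false; not; T?)
open import Data.Fin using (Fin; zero; suc; toℕ; _↑ˡ_; _↑ʳ_; combine; remQuot)
open import Data.Fin.Permutation using (cast-id)
open import Data.Fin.Properties using (remQuot-combine; combine-remQuot; toℕ-combine; toℕ-cast)
open import Data.List using (List; _∷_; map; concat; tabulate; length; filterᵇ; _++_)
open import Data.List.Properties using (filter-++; length-++; map-tabulate)
open import Data.Nat using (zero; suc; _+_; _*_; _∸_; _%_; _≡ᵇ_; z≤n; s≤s; parity)
open import Data.Nat.Divisibility using (divides)
open import Data.Nat.DivMod using (m*n/n≡m)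
open import Data.Nat.Properties
  using (+-*-semiring; module ≤-Reasoning; +-assoc; +-identityʳ; *-suc; *-assoc; ≤-trans; +-mono-≤; m≤n+m; m≤m*n; m≤n*m; *-cancelˡ-≤)
open import Algebra.Properties.Semiring.Sum +-*-semiring
  using (sum; sum-syntax; sum-cong-≗; sum-permute; sum-replicate-zero; ∑-comm; ∑-distrib-+; *-distribˡ-sum)
open import Data.Parity.Base as ℙ using (Parity; 0ℙ; 1ℙ) renaming (_+_ to _⊕_)
open import Data.Parity.Properties as ℙ using (+-homo-+; *-homo-*; p+p≡0ℙ)
open import Data.Product using (_,_; proj₁; proj₂; uncurry)
open import Data.Sum using (inj₁; inj₂)
open import Data.Unit using (tt)
open import Function using (_∘_; flip)
open import Function.Bundles using (_⤖_; _↔_; Bijection; mk↔ₛ′)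
open import Function.Construct.Composition using (_↔-∘_)
open import Function.Construct.Symmetry using (↔-sym)
open import Function.Properties.Bijection using (⤖⇒↔)
open import Function.Properties.Inverse using (↔⇒⤖)
open import Relation.Binary.PropositionalEquality using (refl; sym; trans; cong; cong₂; subst; module ≡-Reasoning)

infixr 5 _∙_
_∙_ : ∀ {A : Set} {x y z : A} → x ≡ y → y ≡ z → x ≡ z
_∙_ = trans

boolToℕ : Bool → ℕ
boolToℕ true = 1
boolToℕ false = 0

bit : Parity → ℕ
bit 0ℙ = 0
bit 1ℙ = 1

bit≤1 : ∀ p → bit p ≤ 1
bit≤1 0ℙ = z≤n
bit≤1 1ℙ = s≤s z≤n

%2≡bit∘parity : ∀ a → a % 2 ≡ bit (parity a)
%2≡bit∘parity 0 = refl
%2≡bit∘parity 1 = refl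
%2≡bit∘parity (suc (suc a)) = %2≡bit∘parity a

isNegative≡bit⊕ : ∀ a b → boolToℕ (isNegative a b) ≡ bit (parity a ⊕ parity b)
isNegative≡bit⊕ a b =
  cong₂ (λ x y → boolToℕ (not (x ≡ᵇ y))) (%2≡bit∘parity a) (%2≡bit∘parity b) ∙ differ (parity a) (parity b)
  where
  differ : ∀ p q → boolToℕ (not (bit p ≡ᵇ bit q)) ≡ bit (p ⊕ q)
  differ 0ℙ 0ℙ = refl
  differ 0ℙ 1ℙ = refl
  differ 1ℙ 0ℙ = refl
  differ 1ℙ 1ℙ = refl

parity-*2*+ : ∀ m a b → parity (m * 2 * a + b) ≡ parity b
parity-*2*+ m a b = begin
  parity (m * 2 * a + b)                  ≡⟨ +-homo-+ (m * 2 * a) b ⟩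
  parity (m * 2 * a) ⊕ parity b           ≡⟨ cong (_⊕ parity b) (*-homo-* (m * 2) a) ⟩
  parity (m * 2) ℙ.* parity a ⊕ parity b  ≡⟨ cong (λ q → q ℙ.* parity a ⊕ parity b) (*-homo-* m 2 ∙ ℙ.*-zeroʳ (parity m)) ⟩
  parity b                                ∎
  where open ≡-Reasoning

∑-mono-≤ : ∀ {n} {f g : Fin n → ℕ} → (∀ i → f i ≤ g i) → sum f ≤ sum g
∑-mono-≤ {zero} f≤g = z≤n
∑-mono-≤ {suc n} f≤g = +-mono-≤ (f≤g zero) (∑-mono-≤ (f≤g ∘ suc))

∑-↑ : ∀ m {n} (g : Fin (m + n) → ℕ) →
      ∑[ x < m + n ] g x ≡ ∑[ i < m ] g (i ↑ˡ n) + ∑[ j < n ] g (m ↑ʳ j)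
∑-↑ zero g = refl
∑-↑ (suc m) g = cong (g zero +_) (∑-↑ m (g ∘ suc)) ∙ sym (+-assoc (g zero) _ _)

∑-combine : ∀ m {n} (g : Fin (m * n) → ℕ) →
            ∑[ x < m * n ] g x ≡ ∑[ i < m ] ∑[ j < n ] g (combine i j)
∑-combine zero g = refl
∑-combine (suc m) {n} g = ∑-↑ n g ∙ cong (∑[ j < n ] g (j ↑ˡ (m * n)) +_) (∑-combine m (g ∘ (n ↑ʳ_)))

∑-bit≤ : ∀ {k} (g : Fin k → Parity) → ∑[ j < k ] bit (g j) ≤ k
∑-bit≤ {zero} g = z≤n
∑-bit≤ {suc k} g = +-mono-≤ (bit≤1 (g zero)) (∑-bit≤ (g ∘ suc))

∑-parityMismatch : ∀ m π → ∑[ x < m * 2 ] bit (π ⊕ parity (toℕ x)) ≡ m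
∑-parityMismatch zero π = refl
∑-parityMismatch (suc m) 0ℙ = cong suc (∑-parityMismatch m 0ℙ)
∑-parityMismatch (suc m) 1ℙ = cong suc (∑-parityMismatch m 1ℙ)

∑-labelParityMismatch≥ : ∀ {p} m π → p ≡ suc (m * 2) → m ≤ ∑[ x < p ] bit (π ⊕ parity (suc (toℕ x)))
∑-labelParityMismatch≥ m π refl =
  subst (_≤ bit (π ⊕ 1ℙ) + ∑[ x < m * 2 ] bit (π ⊕ parity (toℕ x))) (∑-parityMismatch m π) (m≤n+m _ _)

count : ∀ {A : Set} → (A → Bool) → List A → ℕ
count p xs = length (filterᵇ p xs)

count-∷ : ∀ {A : Set} (p : A → Bool) x xs → count p (x ∷ xs) ≡ boolToℕ (p x) + count p xs
count-∷ p x xs with p x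
... | true = refl
... | false = refl

count-++ : ∀ {A : Set} (p : A → Bool) xs ys → count p (xs ++ ys) ≡ count p xs + count p ys
count-++ p xs ys = cong length (filter-++ (T? ∘ p) xs ys) ∙ length-++ (filterᵇ p xs)

count-tabulate : ∀ {A : Set} (p : A → Bool) {n} (g : Fin n → A) →
                 count p (tabulate g) ≡ ∑[ i < n ] boolToℕ (p (g i))
count-tabulate p {zero} g = refl
count-tabulate p {suc n} g = count-∷ p (g zero) _ ∙ cong (boolToℕ (p (g zero)) +_) (count-tabulate p (g ∘ suc))

count-concat-tabulate : ∀ {A : Set} (p : A → Bool) {n} (g : Fin n → List A) →
                        count p (concat (tabulate g)) ≡ ∑[ i < n ] count p (g i)
count-concat-tabulate p {zero} g = refl
count-concat-tabulate p {suc n} g = count-++ p (g zero) _ ∙ cong (count p (g zero) +_) (count-concat-tabulate p (g ∘ suc))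

colouring : ∀ {n} → Labelling (perfectTreeDepth2 n) → PVertex n → Parity
colouring {n} f v = parity (label (perfectTreeDepth2 n) f v)

branchNegatives : ∀ {n} → (PVertex n → Parity) → Fin n → ℕ
branchNegatives {n} c i = bit (c root ⊕ c (mid i)) + ∑[ j < n ∸ 1 ] bit (c (mid i) ⊕ c (leaf i j))

negEdges≡∑branchNegatives : ∀ n (f : Labelling (perfectTreeDepth2 n)) →
                            negEdges (perfectTreeDepth2 n) f ≡ ∑[ i < n ] branchNegatives (colouring f) i
negEdges≡∑branchNegatives n f = begin
  negEdges T f
    ≡⟨ cong₂ (λ xs ys → count negative (xs ++ concat ys)) (map-tabulate (λ i → i) rootEdge) (map-tabulate (λ i → i) leafEdges) ⟩
  count negative (tabulate rootEdge ++ concat (tabulate leafEdges))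
    ≡⟨ count-++ negative (tabulate rootEdge) _ ⟩
  count negative (tabulate rootEdge) + count negative (concat (tabulate leafEdges))
    ≡⟨ cong₂ _+_ (count-tabulate negative rootEdge ∙ sum-cong-≗ λ i → edgeBit root (mid i))
                 (count-concat-tabulate negative leafEdges ∙ sum-cong-≗ λ i →
                    cong (count negative) (map-tabulate (λ j → j) (leafEdge i))
                    ∙ count-tabulate negative (leafEdge i) ∙ sum-cong-≗ λ j → edgeBit (mid i) (leaf i j)) ⟩
  ∑[ i < n ] rootNegative i + ∑[ i < n ] leafNegatives i
    ≡⟨ sym (∑-distrib-+ rootNegative leafNegatives) ⟩
  ∑[ i < n ] branchNegatives c i ∎
  where
  open ≡-Reasoning
  T = perfectTreeDepth2 n
  k = n ∸ 1
  c = colouring f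
  negative : PVertex n × PVertex n → Bool
  negative e = isNegative (label T f (proj₁ e)) (label T f (proj₂ e))
  rootEdge : Fin n → PVertex n × PVertex n
  rootEdge i = root , mid i
  leafEdge : Fin n → Fin k → PVertex n × PVertex n
  leafEdge i j = mid i , leaf i j
  leafEdges : Fin n → List (PVertex n × PVertex n)
  leafEdges i = map (leafEdge i) (allFin k)
  rootNegative leafNegatives : Fin n → ℕ
  rootNegative i = bit (c root ⊕ c (mid i))
  leafNegatives i = ∑[ j < k ] bit (c (mid i) ⊕ c (leaf i j))
  edgeBit : ∀ u v → boolToℕ (negative (u , v)) ≡ bit (c u ⊕ c v)
  edgeBit u v = isNegative≡bit⊕ (label T f u) (label T f v)

disagreements≤size*negatives : ∀ {k} r b (l : Fin k → Parity) →
  bit (r ⊕ b) + ∑[ j < k ] bit (r ⊕ l j) ≤ suc k * (bit (r ⊕ b) + ∑[ j < k ] bit (b ⊕ l j))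
disagreements≤size*negatives {k} 0ℙ 0ℙ l = m≤n*m _ (suc k)
disagreements≤size*negatives {k} 1ℙ 1ℙ l = m≤n*m _ (suc k)
disagreements≤size*negatives {k} 0ℙ 1ℙ l = ≤-trans (s≤s (∑-bit≤ l)) (m≤m*n (suc k) _)
disagreements≤size*negatives {k} 1ℙ 0ℙ l = ≤-trans (s≤s (∑-bit≤ λ j → 1ℙ ⊕ l j)) (m≤m*n (suc k) _)

order-perfectTreeDepth2 : ∀ k → order (perfectTreeDepth2 (suc k)) ≡ suc (suc k * suc k)
order-perfectTreeDepth2 k = cong suc (sym (*-suc (suc k) k))

module Enumeration (k : ℕ) where

  node : Fin (suc k) → Fin (suc k) → PVertex (suc k)
  node i zero = mid i
  node i (suc j) = leaf i j

  vertexAt : Fin (suc (suc k * suc k)) → PVertex (suc k)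
  vertexAt zero = root
  vertexAt (suc x) = uncurry (flip node) (remQuot (suc k) x)

  nodeIndex : Fin (suc k) → Fin (suc k) → Fin (suc (suc k * suc k))
  nodeIndex i pos = suc (combine pos i)

  indexOf : PVertex (suc k) → Fin (suc (suc k * suc k))
  indexOf (inj₁ tt) = zero
  indexOf (inj₂ (inj₁ i)) = nodeIndex i zero
  indexOf (inj₂ (inj₂ (i , j))) = nodeIndex i (suc j)

  indexOf-node : ∀ i pos → indexOf (node i pos) ≡ nodeIndex i pos
  indexOf-node i zero = refl
  indexOf-node i (suc j) = refl

  vertexAt-nodeIndex : ∀ i pos → vertexAt (nodeIndex i pos) ≡ node i pos
  vertexAt-nodeIndex i pos = cong (uncurry (flip node)) (remQuot-combine pos i)

  vertexAt-indexOf : ∀ v → vertexAt (indexOf v) ≡ v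
  vertexAt-indexOf (inj₁ tt) = refl
  vertexAt-indexOf (inj₂ (inj₁ i)) = vertexAt-nodeIndex i zero
  vertexAt-indexOf (inj₂ (inj₂ (i , j))) = vertexAt-nodeIndex i (suc j)

  indexOf-vertexAt : ∀ x → indexOf (vertexAt x) ≡ x
  indexOf-vertexAt zero = refl
  indexOf-vertexAt (suc x) = indexOf-node (proj₂ q) (proj₁ q) ∙ cong suc (combine-remQuot (suc k) x)
    where q = remQuot (suc k) x

  vertices : Fin (suc (suc k * suc k)) ↔ PVertex (suc k)
  vertices = mk↔ₛ′ vertexAt indexOf vertexAt-indexOf indexOf-vertexAt

  ∑-vertices : (h : PVertex (suc k) → ℕ) →
    ∑[ x < suc (suc k * suc k) ] h (vertexAt x) ≡ h root + ∑[ i < suc k ] ∑[ pos < suc k ] h (node i pos)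
  ∑-vertices h = cong (h root +_)
    (∑-combine (suc k) (h ∘ vertexAt ∘ suc)
     ∙ sum-cong-≗ (λ pos → sum-cong-≗ λ i → cong h (vertexAt-nodeIndex i pos))
     ∙ ∑-comm (λ pos i → h (node i pos)))

  ∑-labels : ∀ {p} (f : PVertex (suc k) ⤖ Fin p) (g : Fin p → ℕ) →
    ∑[ x < p ] g x ≡ g (Bijection.to f root) + ∑[ i < suc k ] ∑[ pos < suc k ] g (Bijection.to f (node i pos))
  ∑-labels f g = sum-permute g (⤖⇒↔ f ↔-∘ vertices) ∙ ∑-vertices (g ∘ Bijection.to f)

  positionMajor : Labelling (perfectTreeDepth2 (suc k))
  positionMajor = ↔⇒⤖ (cast-id (sym (order-perfectTreeDepth2 k)) ↔-∘ ↔-sym vertices)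

  label-positionMajor : ∀ i pos →
    label (perfectTreeDepth2 (suc k)) positionMajor (node i pos) ≡ 2 + (suc k * toℕ pos + toℕ i)
  label-positionMajor i pos =
    cong suc (toℕ-cast _ (indexOf (node i pos)) ∙ cong toℕ (indexOf-node i pos))
    ∙ cong (2 +_) (toℕ-combine pos i)

module _ (m : ℕ) where

  open Enumeration (suc (m * 2))

  colouring-positionMajor : ∀ i pos → colouring positionMajor (node i pos) ≡ parity (toℕ i)
  colouring-positionMajor i pos =
    cong parity (label-positionMajor i pos) ∙ parity-*2*+ (suc m) (toℕ pos) (toℕ i)

  branchNegatives-positionMajor : ∀ i → branchNegatives (colouring positionMajor) i ≡ bit (1ℙ ⊕ parity (toℕ i))
  branchNegatives-positionMajor i =
    cong₂ _+_ (cong (λ q → bit (1ℙ ⊕ q)) (colouring-positionMajor i zero))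
              (sum-cong-≗ (λ j → cong bit (cong₂ _⊕_ (colouring-positionMajor i zero) (colouring-positionMajor i (suc j))
                                            ∙ p+p≡0ℙ (parity (toℕ i))))
               ∙ sum-replicate-zero (suc (m * 2)))
    ∙ +-identityʳ _

  negEdges-positionMajor : negEdges (perfectTreeDepth2 (suc m * 2)) positionMajor ≡ suc m
  negEdges-positionMajor =
    negEdges≡∑branchNegatives (suc m * 2) positionMajor
    ∙ sum-cong-≗ branchNegatives-positionMajor
    ∙ ∑-parityMismatch (suc m) 1ℙ

  suc-m≤negEdges : (f : Labelling (perfectTreeDepth2 (suc m * 2))) → suc m ≤ negEdges (perfectTreeDepth2 (suc m * 2)) f
  suc-m≤negEdges f = *-cancelˡ-≤ n (begin
    n * suc m
      ≤⟨ ∑-labelParityMismatch≥ (n * suc m) r order≡ ⟩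
    ∑[ x < order T ] bit (r ⊕ parity (suc (toℕ x)))
      ≡⟨ ∑-labels f (λ x → bit (r ⊕ parity (suc (toℕ x)))) ∙ cong (λ z → bit z + ∑[ i < n ] disagreements i) (p+p≡0ℙ r) ⟩
    ∑[ i < n ] disagreements i
      ≤⟨ ∑-mono-≤ (λ i → disagreements≤size*negatives r (c (mid i)) (λ j → c (leaf i j))) ⟩
    ∑[ i < n ] (n * branchNegatives c i)
      ≡⟨ sym (*-distribˡ-sum n (branchNegatives c)) ⟩
    n * ∑[ i < n ] branchNegatives c i
      ≡⟨ cong (n *_) (sym (negEdges≡∑branchNegatives n f)) ⟩
    n * negEdges T f ∎)
    where
    open ≤-Reasoning
    n = suc m * 2
    T = perfectTreeDepth2 n
    c = colouring f
    r = c root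
    disagreements : Fin n → ℕ
    disagreements i = ∑[ pos < n ] bit (r ⊕ c (node i pos))
    order≡ : order T ≡ suc (n * suc m * 2)
    order≡ = order-perfectTreeDepth2 (suc (m * 2)) ∙ cong suc (sym (*-assoc n (suc m) 2))

mainTheorem7 : (n : ℕ) → 2 < n → 2 ∣ n →
    Σ (Labelling (perfectTreeDepth2 n))
      (λ f → negEdges (perfectTreeDepth2 n) f ≡ n / 2)
    × ((f : Labelling (perfectTreeDepth2 n)) →
        n / 2 ≤ negEdges (perfectTreeDepth2 n) f)
mainTheorem7 _ () (divides zero refl)
mainTheorem7 _ _ (divides (suc m) refl) =
    (Enumeration.positionMajor (suc (m * 2)) , negEdges-positionMajor m ∙ sym half)
  , λ f → subst (_≤ negEdges (perfectTreeDepth2 (suc m * 2)) f) (sym half) (suc-m≤negEdges m f)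
  where
  half : suc m * 2 / 2 ≡ suc m
  half = m*n/n≡m (suc m) 2
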